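{- Let $f,g,h$ be quasi-polynomials with $f(t)=g(t)+h(t)$, and let $k$ be an integer. Then $\tilde f^{k}(t)=\tilde g^{k}(t)+\tilde h^{k}(t)$.
   Context: A quasi-polynomial is a function $f:\mathbb{Z}\to\mathbb{C}$ for which there exist a positive integer $N$ (a period) and polynomials $f_1,\dots,f_N$ (constituents) with $f(t)=f_j(t)$ for $t\equiv j\bmod N$; the minimal period is the least period. For a quasi-polynomial $f$ with minimal period $N$ and constituents $f_j$ (indices mod $N$) and $m\in\mathbb{Z}$, $f^{\sigma^m}$ denotes the quasi-polynomial with $f^{\sigma^m}(t)=f_{j-m}(t)$ for $t\equiv j\bmod N$, and $\tilde f^{k}(t):=\frac{1}{N}\sum_{i=0}^{N-1}f^{\sigma^{ik}}(t)$, where $N$ is the minimal period of $f$ (and analogously for $g$, $h$ with their own minimal periods). -}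

module Defs where

open import Level using (Level; _⊔_)
open import Algebra.Bundles using (CommutativeRing)
open import Data.Nat as ℕ using (ℕ; zero; suc; NonZero; _≤_)
open import Data.Integer as ℤ using (ℤ; +_; -[1+_]; _%ℕ_)
open import Data.List using (List; []; _∷_)
open import Data.Product using (Σ; _×_)
open import Relation.Nullary using (¬_)
open import Relation.Binary.PropositionalEquality using (_≡_)

module _ {c ℓ : Level} (R : CommutativeRing c ℓ) where
  open CommutativeRing R

  fromℕ : ℕ → Carrier
  fromℕ zero    = 0#
  fromℕ (suc n) = 1# + fromℕ n

  fromℤ : ℤ → Carrier
  fromℤ (+ n)      = fromℕ n
  fromℤ -[1+ n ]   = - fromℕ (suc n)

  -- A field of characteristic zero (constructive: inverses of elements
  -- apart from 0).  ℂ is an instance.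
  record IsChar0Field : Set (c ⊔ ℓ) where
    field
      0≉1   : ¬ (0# ≈ 1#)
      inv   : (x : Carrier) → ¬ (x ≈ 0#) → Carrier
      inv-r : (x : Carrier) (p : ¬ (x ≈ 0#)) → x * inv x p ≈ 1#
      char0 : (n : ℕ) → fromℕ n ≈ 0# → n ≡ 0

  -- Polynomials as coefficient lists, lowest degree first.
  Poly : Set c
  Poly = List Carrier

  eval : Poly → Carrier → Carrier
  eval []       x = 0#
  eval (a ∷ as) x = a + x * eval as x

  sumTo : ℕ → (ℕ → Carrier) → Carrier
  sumTo zero    u = 0#
  sumTo (suc n) u = sumTo n u + u n

  -- cs : ℕ → Poly  are constituents for f with period N:
  -- f(t) = cs_j(t) whenever t ≡ j mod N  (only cs 0 … cs (N-1) matter).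
  HasConstituents : (f : ℤ → Carrier) (N : ℕ) .{{_ : NonZero N}} → (ℕ → Poly) → Set ℓ
  HasConstituents f N cs = (t : ℤ) → f t ≈ eval (cs (t %ℕ N)) (fromℤ t)

  IsPeriod : (f : ℤ → Carrier) (N : ℕ) .{{_ : NonZero N}} → Set (c ⊔ ℓ)
  IsPeriod f N = Σ (ℕ → Poly) (HasConstituents f N)

  IsMinimalPeriod : (f : ℤ → Carrier) (N : ℕ) .{{_ : NonZero N}} → Set (c ⊔ ℓ)
  IsMinimalPeriod f N =
    IsPeriod f N × ((P : ℕ) .{{_ : NonZero P}} → IsPeriod f P → N ≤ P)

  -- f^{σ^m}(t) = f_{j-m}(t) for t ≡ j mod N, constituents cs w.r.t. N
  shiftQP : (N : ℕ) .{{_ : NonZero N}} → (ℕ → Poly) → ℤ → ℤ → Carrier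
  shiftQP N cs m t = eval (cs ((t ℤ.- m) %ℕ N)) (fromℤ t)

module _ {c ℓ : Level} (R : CommutativeRing c ℓ) (F : IsChar0Field R) where
  open CommutativeRing R
  open IsChar0Field F

  private
    fromℕ-nz : (N : ℕ) .{{_ : NonZero N}} → ¬ (fromℕ R N ≈ 0#)
    fromℕ-nz (suc n) p with char0 (suc n) p
    ... | ()

  invℕ : (N : ℕ) .{{_ : NonZero N}} → Carrier
  invℕ N = inv (fromℕ R N) (fromℕ-nz N)

  -- f̃^k(t) = (1/N) Σ_{i=0}^{N-1} f^{σ^{ik}}(t), with N and cs the minimal
  -- period and the corresponding constituents of f
  tildeQP : (N : ℕ) .{{_ : NonZero N}} → (ℕ → Poly R) → ℤ → ℤ → Carrier
  tildeQP N cs k t = invℕ N * sumTo R N (λ i → shiftQP R N cs (+ i ℤ.* k) t)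

-- Every period divides L = Nf · Ng · Nh, and averaging an N-periodic sequence over L instead of N
-- changes nothing, so all three averages may be taken over L and compared termwise.  Termwise
-- the constituents satisfy cf (z mod Nf) = cg (z mod Ng) + ch (z mod Nh) as polynomials: the two
-- sides agree at the infinitely many integers z mod L + L s, and in characteristic zero a
-- polynomial vanishing at infinitely many distinct points is zero.

module Submission where

open import Defs
open import Level using (Level)
open import Algebra.Bundles using (CommutativeRing)
open import Data.Nat as ℕ using (ℕ; zero; suc; NonZero; _<_)
import Data.Nat.Properties as ℕ
import Data.Nat.Divisibility as ℕ
open import Data.Integer as ℤ using (ℤ; +_; _%ℕ_; _/ℕ_; ∣_∣)
import Data.Integer.Properties as ℤ
open import Data.Integer.DivMod using (a≡a%ℕn+[a/ℕn]*n; n%ℕd<d)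
open import Data.Integer.Divisibility.Signed
  using (_∣_; divides; ∣ᵤ⇒∣; ∣⇒∣ᵤ; ∣m+n∣n⇒∣m; ∣-trans)
open import Data.Integer.Tactic.RingSolver using (solve-∀)
open import Data.List using ([]; _∷_; length)
open import Data.Maybe using (nothing)
open import Data.Empty using (⊥-elim)
open import Data.Sum using (inj₁; inj₂)
open import Function.Definitions using (Injective)
open import Relation.Nullary using (¬_)
open import Relation.Binary.PropositionalEquality as ≡ using (_≡_)
open import Tactic.RingSolver.Core.AlmostCommutativeRing using (fromCommutativeRing)

∣∧<⇒≡0 : ∀ {n d} → n ℕ.∣ d → d < n → d ≡ 0
∣∧<⇒≡0 {d = zero}  _   _   = ≡.refl
∣∧<⇒≡0 {d = suc _} n∣d d<n = ⊥-elim (ℕ.>⇒∤ d<n n∣d)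

∣i-j⇒i%ℕn≡j%ℕn : ∀ n .{{_ : NonZero n}} i j → + n ∣ i ℤ.- j → i %ℕ n ≡ j %ℕ n
∣i-j⇒i%ℕn≡j%ℕn n i j n∣i-j = ℤ.+-injective (ℤ.i-j≡0⇒i≡j (+ r) (+ r′) (ℤ.∣i∣≡0⇒i≡0 ∣d∣≡0))
  where
  open ≡.≡-Reasoning
  r  = i %ℕ n
  r′ = j %ℕ n

  rearrange : ∀ a b c d m → (a ℤ.+ c ℤ.* m) ℤ.- (b ℤ.+ d ℤ.* m) ≡ (a ℤ.- b) ℤ.+ (c ℤ.- d) ℤ.* m
  rearrange = solve-∀

  i-j≡d+qn : i ℤ.- j ≡ (+ r ℤ.- + r′) ℤ.+ (i /ℕ n ℤ.- j /ℕ n) ℤ.* + n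
  i-j≡d+qn = begin
    i ℤ.- j
      ≡⟨ ≡.cong₂ ℤ._-_ (a≡a%ℕn+[a/ℕn]*n i n) (a≡a%ℕn+[a/ℕn]*n j n) ⟩
    (+ r ℤ.+ i /ℕ n ℤ.* + n) ℤ.- (+ r′ ℤ.+ j /ℕ n ℤ.* + n)
      ≡⟨ rearrange (+ r) (+ r′) (i /ℕ n) (j /ℕ n) (+ n) ⟩
    (+ r ℤ.- + r′) ℤ.+ (i /ℕ n ℤ.- j /ℕ n) ℤ.* + n ∎

  n∣d : + n ∣ + r ℤ.- + r′
  n∣d = ∣m+n∣n⇒∣m (≡.subst (+ n ∣_) i-j≡d+qn n∣i-j) (divides (i /ℕ n ℤ.- j /ℕ n) ≡.refl)

  ∣d∣<n : ∣ + r ℤ.- + r′ ∣ < n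
  ∣d∣<n = ℕ.≤-<-trans
    (≡.subst (ℕ._≤ r ℕ.⊔ r′) (≡.cong ∣_∣ (≡.sym (ℤ.[+m]-[+n]≡m⊖n r r′))) (ℤ.∣m⊝n∣≤m⊔n r r′))
    (ℕ.⊔-pres-<m (n%ℕd<d i n) (n%ℕd<d j n))

  ∣d∣≡0 : ∣ + r ℤ.- + r′ ∣ ≡ 0
  ∣d∣≡0 = ∣∧<⇒≡0 (∣⇒∣ᵤ n∣d) ∣d∣<n

module FromℕHomomorphism {a ℓ : Level} (R : CommutativeRing a ℓ) where
  open CommutativeRing R
  open import Algebra.Properties.Semiring.Mult semiring using (_×_; ×-homo-+; ×1-homo-*)

  fromℕ≡×1# : ∀ n → fromℕ R n ≡ n × 1#
  fromℕ≡×1# zero    = ≡.refl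
  fromℕ≡×1# (suc n) = ≡.cong (λ x → 1# + x) (fromℕ≡×1# n)

  fromℕ-+ : ∀ m n → fromℕ R (m ℕ.+ n) ≈ fromℕ R m + fromℕ R n
  fromℕ-+ m n
    rewrite fromℕ≡×1# (m ℕ.+ n) | fromℕ≡×1# m | fromℕ≡×1# n = ×-homo-+ 1# m n

  fromℕ-* : ∀ m n → fromℕ R (m ℕ.* n) ≈ fromℕ R m * fromℕ R n
  fromℕ-* m n
    rewrite fromℕ≡×1# (m ℕ.* n) | fromℕ≡×1# m | fromℕ≡×1# n = ×1-homo-* m n

module Polynomials {a ℓ : Level} (R : CommutativeRing a ℓ) where
  open CommutativeRing R
  open import Algebra.Properties.Ring ring using (-‿distribʳ-*; -‿+-comm; -0#≈0#)
  open import Tactic.RingSolver.NonReflective (fromCommutativeRing R (λ _ → nothing))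
    using (solve; _⊜_; _⊕_; _⊗_)
  open import Relation.Binary.Reasoning.Setoid setoid

  infixl 6 _+ₚ_ _-ₚ_

  _+ₚ_ : Poly R → Poly R → Poly R
  []       +ₚ q        = q
  (a ∷ as) +ₚ []       = a ∷ as
  (a ∷ as) +ₚ (b ∷ bs) = (a + b) ∷ (as +ₚ bs)

  negₚ : Poly R → Poly R
  negₚ []       = []
  negₚ (a ∷ as) = - a ∷ negₚ as

  _-ₚ_ : Poly R → Poly R → Poly R
  p -ₚ q = p +ₚ negₚ q

  eval-+ₚ : ∀ p q y → eval R (p +ₚ q) y ≈ eval R p y + eval R q y
  eval-+ₚ []       q        y = sym (+-identityˡ _)
  eval-+ₚ (a ∷ as) []       y = sym (+-identityʳ _)
  eval-+ₚ (a ∷ as) (b ∷ bs) y = begin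
    (a + b) + y * eval R (as +ₚ bs) y         ≈⟨ +-congˡ (*-congˡ (eval-+ₚ as bs y)) ⟩
    (a + b) + y * (eval R as y + eval R bs y) ≈⟨ regroup a b y (eval R as y) (eval R bs y) ⟩
    (a + y * eval R as y) + (b + y * eval R bs y) ∎
    where
    regroup : ∀ a b y u v → (a + b) + y * (u + v) ≈ (a + y * u) + (b + y * v)
    regroup = solve 5 (λ a b y u v → ((a ⊕ b) ⊕ y ⊗ (u ⊕ v)) ⊜ ((a ⊕ y ⊗ u) ⊕ (b ⊕ y ⊗ v))) refl

  eval-negₚ : ∀ p y → eval R (negₚ p) y ≈ - eval R p y
  eval-negₚ []       y = sym -0#≈0#
  eval-negₚ (a ∷ as) y = begin
    - a + y * eval R (negₚ as) y ≈⟨ +-congˡ (*-congˡ (eval-negₚ as y)) ⟩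
    - a + y * - eval R as y    ≈⟨ +-congˡ (sym (-‿distribʳ-* y (eval R as y))) ⟩
    - a + - (y * eval R as y)  ≈⟨ -‿+-comm a (y * eval R as y) ⟩
    - (a + y * eval R as y)    ∎

  eval--ₚ : ∀ p q y → eval R (p -ₚ q) y ≈ eval R p y - eval R q y
  eval--ₚ p q y = trans (eval-+ₚ p (negₚ q) y) (+-congˡ (eval-negₚ q y))

  -- Synthetic division by X - c: the coefficients are the values at c of the tails of p.
  quotient : Carrier → Poly R → Poly R
  quotient c []           = []
  quotient c (a ∷ [])     = []
  quotient c (a ∷ b ∷ bs) = eval R (b ∷ bs) c ∷ quotient c (b ∷ bs)

  length-quotient : ∀ c a as → length (quotient c (a ∷ as)) ≡ length as
  length-quotient c a []       = ≡.refl
  length-quotient c a (b ∷ bs) = ≡.cong suc (length-quotient c b bs)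

  eval-cong : ∀ p {x y} → x ≈ y → eval R p x ≈ eval R p y
  eval-cong []       x≈y = refl
  eval-cong (a ∷ as) x≈y = +-congˡ (*-cong x≈y (eval-cong as x≈y))

  factor-theorem : ∀ c d p → eval R p (c + d) ≈ eval R p c + d * eval R (quotient c p) (c + d)
  factor-theorem c d [] = sym (trans (+-identityˡ _) (zeroʳ d))
  factor-theorem c d (a ∷ []) = begin
    a + (c + d) * 0#         ≈⟨ +-congˡ (zeroʳ (c + d)) ⟩
    a + 0#                   ≈⟨ +-identityʳ _ ⟨
    (a + 0#) + 0#            ≈⟨ +-cong (+-congˡ (zeroʳ c)) (zeroʳ d) ⟨
    (a + c * 0#) + d * 0#    ∎
  factor-theorem c d (a ∷ b ∷ bs) = begin
    a + (c + d) * eval R p (c + d)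
      ≈⟨ +-congˡ (*-congˡ (factor-theorem c d (b ∷ bs))) ⟩
    a + (c + d) * (eval R p c + d * eval R q (c + d))
      ≈⟨ regroup a c d (eval R p c) (eval R q (c + d)) ⟩
    (a + c * eval R p c) + d * (eval R p c + (c + d) * eval R q (c + d)) ∎
    where
    p = b ∷ bs
    q = quotient c p
    regroup : ∀ a c d u v → a + (c + d) * (u + d * v) ≈ (a + c * u) + d * (u + (c + d) * v)
    regroup = solve 5 (λ a c d u v →
      (a ⊕ (c ⊕ d) ⊗ (u ⊕ d ⊗ v)) ⊜ ((a ⊕ c ⊗ u) ⊕ d ⊗ (u ⊕ (c ⊕ d) ⊗ v))) refl

module FiniteSums {a ℓ : Level} (R : CommutativeRing a ℓ) where
  open CommutativeRing R
  open import Tactic.RingSolver.NonReflective (fromCommutativeRing R (λ _ → nothing))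
    using (solve; _⊜_; _⊕_)
  open import Relation.Binary.Reasoning.Setoid setoid

  sumTo-cong : ∀ n {u v : ℕ → Carrier} → (∀ i → u i ≈ v i) → sumTo R n u ≈ sumTo R n v
  sumTo-cong zero    u≈v = refl
  sumTo-cong (suc n) u≈v = +-cong (sumTo-cong n u≈v) (u≈v n)

  sumTo-distrib-+ : ∀ n (u v : ℕ → Carrier) →
                    sumTo R n (λ i → u i + v i) ≈ sumTo R n u + sumTo R n v
  sumTo-distrib-+ zero    u v = sym (+-identityˡ 0#)
  sumTo-distrib-+ (suc n) u v = trans (+-congʳ (sumTo-distrib-+ n u v))
    (solve 4 (λ U V a b → ((U ⊕ V) ⊕ (a ⊕ b)) ⊜ ((U ⊕ a) ⊕ (V ⊕ b))) refl
      (sumTo R n u) (sumTo R n v) (u n) (v n))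

  sumTo-split : ∀ m n (u : ℕ → Carrier) →
                sumTo R (m ℕ.+ n) u ≈ sumTo R n u + sumTo R m (λ i → u (n ℕ.+ i))
  sumTo-split zero    n u = sym (+-identityʳ _)
  sumTo-split (suc m) n u = begin
    sumTo R (m ℕ.+ n) u + u (m ℕ.+ n)
      ≈⟨ +-cong (sumTo-split m n u) (reflexive (≡.cong u (ℕ.+-comm m n))) ⟩
    (sumTo R n u + sumTo R m (λ i → u (n ℕ.+ i))) + u (n ℕ.+ m)
      ≈⟨ +-assoc _ _ _ ⟩
    sumTo R n u + (sumTo R m (λ i → u (n ℕ.+ i)) + u (n ℕ.+ m)) ∎

  sumTo-periodic : ∀ n m (u : ℕ → Carrier) → (∀ q i → u (q ℕ.* n ℕ.+ i) ≈ u i) →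
                   sumTo R (m ℕ.* n) u ≈ fromℕ R m * sumTo R n u
  sumTo-periodic n zero    u periodic = sym (zeroˡ _)
  sumTo-periodic n (suc m) u periodic = begin
    sumTo R (n ℕ.+ m ℕ.* n) u
      ≈⟨ sumTo-split n (m ℕ.* n) u ⟩
    sumTo R (m ℕ.* n) u + sumTo R n (λ i → u (m ℕ.* n ℕ.+ i))
      ≈⟨ +-cong (sumTo-periodic n m u periodic) (sumTo-cong n (periodic m)) ⟩
    fromℕ R m * S + S
      ≈⟨ +-comm _ _ ⟩
    S + fromℕ R m * S
      ≈⟨ +-congʳ (*-identityˡ S) ⟨
    1# * S + fromℕ R m * S
      ≈⟨ distribʳ S 1# (fromℕ R m) ⟨
    (1# + fromℕ R m) * S ∎
    where S = sumTo R n u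

module CharacteristicZero {a ℓ : Level} (R : CommutativeRing a ℓ) (F : IsChar0Field R) where
  open CommutativeRing R
  open IsChar0Field F
  open import Algebra.Properties.Ring ring
    using (+-identityʳ-unique; x∙y⁻¹≈ε⇒x≈y; x≈y⇒x∙y⁻¹≈ε; xyx⁻¹≈y)
  open import Relation.Binary.Reasoning.Setoid setoid
  open FromℕHomomorphism R
  open Polynomials R
  open FiniteSums R

  x+[y-x]≈y : ∀ x y → x + (y - x) ≈ y
  x+[y-x]≈y x y = trans (sym (+-assoc x y (- x))) (xyx⁻¹≈y x y)

  x≉0⇒x*y≈0⇒y≈0 : ∀ {x y} → ¬ (x ≈ 0#) → x * y ≈ 0# → y ≈ 0#
  x≉0⇒x*y≈0⇒y≈0 {x} {y} x≉0 xy≈0 = begin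
    y                  ≈⟨ *-identityˡ y ⟨
    1# * y             ≈⟨ *-congʳ (trans (sym (inv-r x x≉0)) (*-comm x _)) ⟩
    (x⁻¹ * x) * y      ≈⟨ *-assoc x⁻¹ x y ⟩
    x⁻¹ * (x * y)      ≈⟨ *-congˡ xy≈0 ⟩
    x⁻¹ * 0#           ≈⟨ zeroʳ x⁻¹ ⟩
    0#                 ∎
    where x⁻¹ = inv x x≉0

  ≤∧fromℕ≈⇒≡ : ∀ {m n} → m ℕ.≤ n → fromℕ R n ≈ fromℕ R m → n ≡ m
  ≤∧fromℕ≈⇒≡ {m} {n} m≤n n≈m = ℕ.≤-antisym (ℕ.m∸n≡0⇒m≤n n∸m≡0) m≤n
    where
    n∸m≡0 : n ℕ.∸ m ≡ 0
    n∸m≡0 = char0 (n ℕ.∸ m) (+-identityʳ-unique (fromℕ R m) _ (begin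
      fromℕ R m + fromℕ R (n ℕ.∸ m) ≈⟨ fromℕ-+ m (n ℕ.∸ m) ⟨
      fromℕ R (m ℕ.+ (n ℕ.∸ m))     ≈⟨ reflexive (≡.cong (fromℕ R) (ℕ.m+[n∸m]≡n m≤n)) ⟩
      fromℕ R n                     ≈⟨ n≈m ⟩
      fromℕ R m                     ∎))

  fromℕ-injective : Injective _≡_ _≈_ (fromℕ R)
  fromℕ-injective {m} {n} m≈n with ℕ.≤-total m n
  ... | inj₁ m≤n = ≡.sym (≤∧fromℕ≈⇒≡ m≤n (sym m≈n))
  ... | inj₂ n≤m = ≤∧fromℕ≈⇒≡ n≤m m≈n

  -- Divide by X - x 0; the quotient is shorter and vanishes at the remaining nodes.
  roots⇒≈0 : ∀ n p → length p ≡ n → (x : ℕ → Carrier) → Injective _≡_ _≈_ x →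
             (∀ s → eval R p (x s) ≈ 0#) → ∀ y → eval R p y ≈ 0#
  roots⇒≈0 _       []       _   x x-inj roots y = refl
  roots⇒≈0 zero    (a ∷ as) ()
  roots⇒≈0 (suc n) (a ∷ as) len x x-inj roots y = begin
    eval R p y                                ≈⟨ eval-cong p (x+[y-x]≈y c y) ⟨
    eval R p (c + (y - c))                    ≈⟨ factor-theorem c (y - c) p ⟩
    eval R p c + (y - c) * eval R q (c + (y - c))
      ≈⟨ +-cong (roots 0) (*-congˡ (q≈0 (c + (y - c)))) ⟩
    0# + (y - c) * 0#                         ≈⟨ trans (+-identityˡ _) (zeroʳ _) ⟩
    0#                                        ∎
    where
    p = a ∷ as
    c = x 0
    q = quotient c p

    q-roots : ∀ s → eval R q (x (suc s)) ≈ 0#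
    q-roots s = x≉0⇒x*y≈0⇒y≈0 d≉0 (begin
      d * eval R q (x (suc s))           ≈⟨ *-congˡ (eval-cong q c+d≈x) ⟨
      d * eval R q (c + d)               ≈⟨ +-identityˡ _ ⟨
      0# + d * eval R q (c + d)          ≈⟨ +-congʳ (roots 0) ⟨
      eval R p c + d * eval R q (c + d)  ≈⟨ factor-theorem c d p ⟨
      eval R p (c + d)                   ≈⟨ eval-cong p c+d≈x ⟩
      eval R p (x (suc s))               ≈⟨ roots (suc s) ⟩
      0#                                 ∎)
      where
      d = x (suc s) - c
      c+d≈x : c + d ≈ x (suc s)
      c+d≈x = x+[y-x]≈y c (x (suc s))
      d≉0 : ¬ (d ≈ 0#)
      d≉0 d≈0 with x-inj (x∙y⁻¹≈ε⇒x≈y _ _ d≈0)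
      ... | ()

    q≈0 : ∀ y → eval R q y ≈ 0#
    q≈0 = roots⇒≈0 n q (≡.trans (length-quotient c a as) (ℕ.suc-injective len))
      (λ s → x (suc s)) (λ eq → ℕ.suc-injective (x-inj eq)) q-roots

  eval-≈-on-injective : ∀ p q (x : ℕ → Carrier) → Injective _≡_ _≈_ x →
                        (∀ s → eval R p (x s) ≈ eval R q (x s)) → ∀ y → eval R p y ≈ eval R q y
  eval-≈-on-injective p q x x-inj agree y = x∙y⁻¹≈ε⇒x≈y _ _
    (trans (sym (eval--ₚ p q y))
      (roots⇒≈0 _ (p -ₚ q) ≡.refl x x-inj
        (λ s → trans (eval--ₚ p q (x s)) (x≈y⇒x∙y⁻¹≈ε (agree s))) y))

  average : (n : ℕ) .{{_ : NonZero n}} → (ℕ → Carrier) → Carrier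
  average n u = invℕ R F n * sumTo R n u

  average-cong : ∀ n .{{_ : NonZero n}} {u v : ℕ → Carrier} →
                 (∀ i → u i ≈ v i) → average n u ≈ average n v
  average-cong n u≈v = *-congˡ (sumTo-cong n u≈v)

  average-distrib-+ : ∀ n .{{_ : NonZero n}} (u v : ℕ → Carrier) →
                      average n (λ i → u i + v i) ≈ average n u + average n v
  average-distrib-+ n u v = trans (*-congˡ (sumTo-distrib-+ n u v)) (distribˡ _ _ _)

  invℕ-*-fromℕ : ∀ m n .{{_ : NonZero n}} .{{_ : NonZero (m ℕ.* n)}} →
                 invℕ R F (m ℕ.* n) * fromℕ R m ≈ invℕ R F n
  invℕ-*-fromℕ m n = begin
    e * fromℕ R m                            ≈⟨ *-identityʳ _ ⟨
    (e * fromℕ R m) * 1#                     ≈⟨ *-congˡ (inv-r (fromℕ R n) _) ⟨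
    (e * fromℕ R m) * (fromℕ R n * i)        ≈⟨ *-assoc _ _ _ ⟨
    ((e * fromℕ R m) * fromℕ R n) * i        ≈⟨ *-congʳ (*-assoc _ _ _) ⟩
    (e * (fromℕ R m * fromℕ R n)) * i        ≈⟨ *-congʳ (*-congˡ (fromℕ-* m n)) ⟨
    (e * fromℕ R (m ℕ.* n)) * i              ≈⟨ *-congʳ (*-comm _ _) ⟩
    (fromℕ R (m ℕ.* n) * e) * i              ≈⟨ *-congʳ (inv-r (fromℕ R (m ℕ.* n)) _) ⟩
    1# * i                                   ≈⟨ *-identityˡ i ⟩
    i                                        ∎
    where
    e = invℕ R F (m ℕ.* n)
    i = invℕ R F n

  average-periodic : ∀ {n L} .{{_ : NonZero n}} .{{_ : NonZero L}} → n ℕ.∣ L →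
                     (u : ℕ → Carrier) → (∀ q i → u (q ℕ.* n ℕ.+ i) ≈ u i) →
                     average L u ≈ average n u
  average-periodic {n} (ℕ.divides m ≡.refl) u periodic = begin
    invℕ R F (m ℕ.* n) * sumTo R (m ℕ.* n) u         ≈⟨ *-congˡ (sumTo-periodic n m u periodic) ⟩
    invℕ R F (m ℕ.* n) * (fromℕ R m * sumTo R n u)   ≈⟨ *-assoc _ _ _ ⟨
    (invℕ R F (m ℕ.* n) * fromℕ R m) * sumTo R n u   ≈⟨ *-congʳ (invℕ-*-fromℕ m n) ⟩
    invℕ R F n * sumTo R n u                         ∎

module QuasiPolynomials {a ℓ : Level} (R : CommutativeRing a ℓ) (F : IsChar0Field R) where
  open CommutativeRing R
  open Polynomials R
  open CharacteristicZero R F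

  shiftQP-periodic : ∀ n .{{_ : NonZero n}} cs k t q i →
                     shiftQP R n cs (+ (q ℕ.* n ℕ.+ i) ℤ.* k) t ≡ shiftQP R n cs (+ i ℤ.* k) t
  shiftQP-periodic n cs k t q i =
    ≡.cong (λ r → eval R (cs r) (fromℤ R t))
      (∣i-j⇒i%ℕn≡j%ℕn n (t ℤ.- + (q ℕ.* n ℕ.+ i) ℤ.* k) (t ℤ.- + i ℤ.* k)
        (divides (ℤ.- (+ q ℤ.* k)) difference))
    where
    rearrange : ∀ t k q i n → (t ℤ.- (q ℤ.* n ℤ.+ i) ℤ.* k) ℤ.- (t ℤ.- i ℤ.* k) ≡ ℤ.- (q ℤ.* k) ℤ.* n
    rearrange = solve-∀
    difference : (t ℤ.- + (q ℕ.* n ℕ.+ i) ℤ.* k) ℤ.- (t ℤ.- + i ℤ.* k) ≡ ℤ.- (+ q ℤ.* k) ℤ.* + n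
    difference = ≡.trans
      (≡.cong (λ z → (t ℤ.- z ℤ.* k) ℤ.- (t ℤ.- + i ℤ.* k))
        (≡.trans (ℤ.pos-+ (q ℕ.* n) i) (≡.cong (ℤ._+ + i) (ℤ.pos-* q n))))
      (rearrange t k (+ q) (+ i) (+ n))

  tildeQP-lift : ∀ {n L} .{{_ : NonZero n}} .{{_ : NonZero L}} → n ℕ.∣ L → ∀ cs k t →
                 tildeQP R F n cs k t ≈ average L (λ i → shiftQP R n cs (+ i ℤ.* k) t)
  tildeQP-lift {n} n∣L cs k t =
    sym (average-periodic n∣L _ (λ q i → reflexive (shiftQP-periodic n cs k t q i)))

  module _ (z : ℤ) (L : ℕ) .{{_ : NonZero L}} where

    node : ℕ → ℕ
    node s = z %ℕ L ℕ.+ L ℕ.* s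

    node-injective : Injective _≡_ _≈_ (λ s → fromℕ R (node s))
    node-injective {r} {s} eq = ℕ.*-cancelˡ-≡ r s L (ℕ.+-cancelˡ-≡ (z %ℕ L) _ _ (fromℕ-injective eq))

    node-%ℕ : ∀ {n} .{{_ : NonZero n}} → n ℕ.∣ L → ∀ s → + node s %ℕ n ≡ z %ℕ n
    node-%ℕ {n} n∣L s =
      ∣i-j⇒i%ℕn≡j%ℕn n (+ node s) z (∣-trans (∣ᵤ⇒∣ n∣L) (divides (+ s ℤ.- z /ℕ L) difference))
      where
      rearrange : ∀ r q l s → (r ℤ.+ l ℤ.* s) ℤ.- (r ℤ.+ q ℤ.* l) ≡ (s ℤ.- q) ℤ.* l
      rearrange = solve-∀
      difference : + node s ℤ.- z ≡ (+ s ℤ.- z /ℕ L) ℤ.* + L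
      difference = ≡.trans
        (≡.cong₂ ℤ._-_
          (≡.trans (ℤ.pos-+ (z %ℕ L) (L ℕ.* s)) (≡.cong (λ w → + (z %ℕ L) ℤ.+ w) (ℤ.pos-* L s)))
          (a≡a%ℕn+[a/ℕn]*n z L))
        (rearrange (+ (z %ℕ L)) (z /ℕ L) (+ L) (+ s))

    constituent-at-node : ∀ {f n} .{{_ : NonZero n}} cs → HasConstituents R f n cs → n ℕ.∣ L →
                          ∀ s → f (+ node s) ≈ eval R (cs (z %ℕ n)) (fromℕ R (node s))
    constituent-at-node cs f≈cs n∣L s = trans (f≈cs (+ node s))
      (reflexive (≡.cong (λ r → eval R (cs r) (fromℕ R (node s))) (node-%ℕ n∣L s)))

  -- Both sides agree at the nodes z mod L + L s, which lie in the residue class of z for each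
  -- of the three periods and are pairwise distinct in characteristic zero.
  constituents-+ : ∀ {f g h : ℤ → Carrier} {nf ng nh : ℕ}
                   .{{_ : NonZero nf}} .{{_ : NonZero ng}} .{{_ : NonZero nh}}
                   (cf cg ch : ℕ → Poly R) →
                   HasConstituents R f nf cf → HasConstituents R g ng cg →
                   HasConstituents R h nh ch →
                   (∀ t → f t ≈ g t + h t) →
                   ∀ L .{{_ : NonZero L}} → nf ℕ.∣ L → ng ℕ.∣ L → nh ℕ.∣ L → ∀ z y →
                   eval R (cf (z %ℕ nf)) y ≈ eval R (cg (z %ℕ ng)) y + eval R (ch (z %ℕ nh)) y
  constituents-+ {f} {g} {h} {nf} {ng} {nh} cf cg ch f≈cf g≈cg h≈ch f≈g+h L nf∣L ng∣L nh∣L z y =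
    trans (eval-≈-on-injective (cf (z %ℕ nf)) (cg (z %ℕ ng) +ₚ ch (z %ℕ nh)) x
             (node-injective z L) agree y)
          (eval-+ₚ (cg (z %ℕ ng)) (ch (z %ℕ nh)) y)
    where
    x : ℕ → Carrier
    x s = fromℕ R (node z L s)
    agree : ∀ s → eval R (cf (z %ℕ nf)) (x s) ≈ eval R (cg (z %ℕ ng) +ₚ ch (z %ℕ nh)) (x s)
    agree s = begin
      eval R (cf (z %ℕ nf)) (x s)
        ≈⟨ constituent-at-node z L cf f≈cf nf∣L s ⟨
      f (+ node z L s)
        ≈⟨ f≈g+h _ ⟩
      g (+ node z L s) + h (+ node z L s)
        ≈⟨ +-cong (constituent-at-node z L cg g≈cg ng∣L s) (constituent-at-node z L ch h≈ch nh∣L s) ⟩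
      eval R (cg (z %ℕ ng)) (x s) + eval R (ch (z %ℕ nh)) (x s)
        ≈⟨ eval-+ₚ (cg (z %ℕ ng)) (ch (z %ℕ nh)) (x s) ⟨
      eval R (cg (z %ℕ ng) +ₚ ch (z %ℕ nh)) (x s) ∎
      where open import Relation.Binary.Reasoning.Setoid setoid

lemma2p9 : {c ℓ : Level} (R : CommutativeRing c ℓ) (F : IsChar0Field R)
           (f g h : ℤ → CommutativeRing.Carrier R)
           (Nf Ng Nh : ℕ) .{{_ : NonZero Nf}} .{{_ : NonZero Ng}} .{{_ : NonZero Nh}}
           (cf cg ch : ℕ → Poly R) →
           IsMinimalPeriod R f Nf → HasConstituents R f Nf cf →
           IsMinimalPeriod R g Ng → HasConstituents R g Ng cg →
           IsMinimalPeriod R h Nh → HasConstituents R h Nh ch →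
           ((t : ℤ) → CommutativeRing._≈_ R (f t) (CommutativeRing._+_ R (g t) (h t))) →
           (k : ℤ) (t : ℤ) →
           CommutativeRing._≈_ R (tildeQP R F Nf cf k t)
             (CommutativeRing._+_ R (tildeQP R F Ng cg k t) (tildeQP R F Nh ch k t))
lemma2p9 R F f g h Nf Ng Nh cf cg ch _ f≈cf _ g≈cg _ h≈ch f≈g+h k t = begin
  tildeQP R F Nf cf k t
    ≈⟨ tildeQP-lift Nf∣L cf k t ⟩
  average L (shift Nf cf)
    ≈⟨ average-cong L constituentwise ⟩
  average L (λ i → shift Ng cg i + shift Nh ch i)
    ≈⟨ average-distrib-+ L (shift Ng cg) (shift Nh ch) ⟩
  average L (shift Ng cg) + average L (shift Nh ch)
    ≈⟨ +-cong (tildeQP-lift Ng∣L cg k t) (tildeQP-lift Nh∣L ch k t) ⟨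
  tildeQP R F Ng cg k t + tildeQP R F Nh ch k t ∎
  where
  open CommutativeRing R
  open CharacteristicZero R F
  open QuasiPolynomials R F
  open import Relation.Binary.Reasoning.Setoid setoid

  L : ℕ
  L = Nf ℕ.* Ng ℕ.* Nh
  instance
    L≢0 : NonZero L
    L≢0 = ℕ.m*n≢0 (Nf ℕ.* Ng) Nh {{ℕ.m*n≢0 Nf Ng}}

  Nf∣L : Nf ℕ.∣ L
  Nf∣L = ℕ.∣-trans (ℕ.m∣m*n Ng) (ℕ.m∣m*n Nh)
  Ng∣L : Ng ℕ.∣ L
  Ng∣L = ℕ.n∣m*n*o Nf Nh
  Nh∣L : Nh ℕ.∣ L
  Nh∣L = ℕ.n∣m*n (Nf ℕ.* Ng)

  shift : ∀ n .{{_ : NonZero n}} → (ℕ → Poly R) → ℕ → Carrier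
  shift n cs i = shiftQP R n cs (+ i ℤ.* k) t

  constituentwise : ∀ i → shift Nf cf i ≈ shift Ng cg i + shift Nh ch i
  constituentwise i =
    constituents-+ cf cg ch f≈cf g≈cg h≈ch f≈g+h L Nf∣L Ng∣L Nh∣L (t ℤ.- + i ℤ.* k) (fromℤ R t)
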